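{- Let $G$ be a graph of order $n$ and let $w=(w_0,\dots,w_l)\in\mathbb{Z}^+\times\mathbb{N}^l$ with $w_0\ge\cdots\ge w_l$. If $G'$ is a spanning subgraph of $G$ with minimum degree $\delta'\ge w_l/l$, then $\gamma_w(G)\le\gamma_w(G')$.
   Context: All graphs are finite and simple; $N(v)$ is the open neighbourhood and $f(S)=\sum_{u\in S}f(u)$. $\mathbb{Z}^+=\{1,2,\dots\}$, $\mathbb{N}=\mathbb{Z}^+\cup\{0\}$. For $w=(w_0,\dots,w_l)$ with nonnegative integer entries and $w_0\ge 1$, a function $f:V(G)\to\{0,\dots,l\}$ is $w$-dominating if $f(N(v))\ge w_i$ for every $v$ with $f(v)=i$; $\gamma_w(G)$ is the minimum of $\sum_v f(v)$ over $w$-dominating functions. -}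

module Defs where

open import Data.Nat using (ℕ; zero; suc; _+_; _≤_)
open import Data.Fin using (Fin; toℕ)
open import Data.Bool using (Bool; true; false; if_then_else_)
open import Data.Product using (Σ; _×_)
open import Relation.Binary.PropositionalEquality using (_≡_)

record Graph (n : ℕ) : Set where
  field
    adj    : Fin n → Fin n → Bool
    sym    : ∀ u v → adj u v ≡ adj v u
    irrefl : ∀ v → adj v v ≡ false
open Graph public

∑ : {n : ℕ} → (Fin n → ℕ) → ℕ
∑ {zero}  f = 0
∑ {suc n} f = f Fin.zero + ∑ (λ i → f (Fin.suc i))

nbSum : {n : ℕ} → Graph n → (Fin n → ℕ) → Fin n → ℕ
nbSum G f v = ∑ (λ u → if adj G v u then f u else 0)

degree : {n : ℕ} → Graph n → Fin n → ℕ
degree G v = nbSum G (λ _ → 1) v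

SpanningSubgraph : {n : ℕ} → Graph n → Graph n → Set
SpanningSubgraph G' G = ∀ u v → adj G' u v ≡ true → adj G u v ≡ true

weight : {n l : ℕ} → (Fin n → Fin (suc l)) → ℕ
weight f = ∑ (λ v → toℕ (f v))

IsWDom : {n l : ℕ} → Graph n → (Fin (suc l) → ℕ) → (Fin n → Fin (suc l)) → Set
IsWDom G w f = ∀ v → w (f v) ≤ nbSum G (λ u → toℕ (f u)) v

IsGammaW : {n l : ℕ} → Graph n → (Fin (suc l) → ℕ) → ℕ → Set
IsGammaW {n} {l} G w k =
  Σ (Fin n → Fin (suc l)) (λ f → IsWDom G w f × weight f ≡ k)
  × (∀ f → IsWDom G w f → k ≤ weight f)

-- Adding edges can only enlarge the neighbourhood sums f(N(v)), so every
-- w-dominating function of the spanning subgraph G' is w-dominating in G, and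
-- the minimum over the larger family is at most the minimum over the smaller.
module Submission where

open import Defs
open import Data.Nat using (ℕ; zero; suc; _≤_; _*_; z≤n)
open import Data.Nat.Properties using (≤-refl; ≤-trans; +-mono-≤)
open import Data.Fin using (Fin; fromℕ; toℕ) renaming (_≤_ to _≤ᶠ_)
open import Data.Bool using (Bool; true; false; if_then_else_)
open import Data.Product using (_,_)
open import Relation.Binary.PropositionalEquality using (_≡_; refl; subst)

∑-mono-≤ : {n : ℕ} {f g : Fin n → ℕ} → (∀ i → f i ≤ g i) → ∑ f ≤ ∑ g
∑-mono-≤ {zero}  f≤g = z≤n
∑-mono-≤ {suc n} f≤g = +-mono-≤ (f≤g Fin.zero) (∑-mono-≤ (λ i → f≤g (Fin.suc i)))

if-mono-≤ : {a b : Bool} → (a ≡ true → b ≡ true) → (x : ℕ) →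
            (if a then x else 0) ≤ (if b then x else 0)
if-mono-≤ {false} a⇒b x = z≤n
if-mono-≤ {true}  a⇒b x with a⇒b refl
... | refl = ≤-refl

nbSum-mono-spanning : {n : ℕ} (G G' : Graph n) → SpanningSubgraph G' G →
                      (f : Fin n → ℕ) (v : Fin n) → nbSum G' f v ≤ nbSum G f v
nbSum-mono-spanning G G' G'⊆G f v = ∑-mono-≤ (λ u → if-mono-≤ (G'⊆G v u) (f u))

IsWDom-spanning : {n l : ℕ} (G G' : Graph n) → SpanningSubgraph G' G →
                  (w : Fin (suc l) → ℕ) (f : Fin n → Fin (suc l)) →
                  IsWDom G' w f → IsWDom G w f
IsWDom-spanning G G' G'⊆G w f dom v =
  ≤-trans (dom v) (nbSum-mono-spanning G G' G'⊆G (λ u → toℕ (f u)) v)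

proposition3p5 : (n l : ℕ) → 1 ≤ l → (w : Fin (suc l) → ℕ)
    → 1 ≤ w Fin.zero
    → (∀ i j → i ≤ᶠ j → w j ≤ w i)
    → (G G' : Graph n) → SpanningSubgraph G' G
    → (∀ v → w (fromℕ l) ≤ l * degree G' v)
    → (k k' : ℕ) → IsGammaW G w k → IsGammaW G' w k'
    → k ≤ k'
proposition3p5 n l _ w _ _ G G' G'⊆G _ k k' (_ , minimalG) ((f' , dom' , weight≡k') , _) =
  subst (k ≤_) weight≡k' (minimalG f' (IsWDom-spanning G G' G'⊆G w f' dom'))
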